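{- Let $n\ge1$ and let $\pi\in S_{n+1}$ be almost consecutive, i.e. $|\pi^{ -1}(i+1)-\pi^{ -1}(i)|\le2$ for all $i\in[n]$. Then every wall of the region $D_\pi$ of the arrangement $\mathcal{D}_n$ is a hyperplane of the type $B$ Coxeter arrangement in $\mathbb{R}^n$.
   Context: For $\mathbf{x}=(x_1,\dots,x_n)\in\mathbb{R}^n$ let $z_1=0$, $z_i=x_1+\cdots+x_{i-1}$ ($2\le i\le n+1$); $D_\pi$ is the set of $\mathbf{x}$ for which the $z_i$ are distinct and $\pi(i)=|\{j:z_i\ge z_j\}|$ for all $i$. $\mathcal{D}_n$ is the arrangement of hyperplanes $H_{i,j}=\{x_i+\cdots+x_{j-1}=0\}$, $1\le i<j\le n+1$; its regions are the sets $D_\pi$. A cell of a central arrangement is a nonempty set determined by choosing a sign in $\{+,0,-\}$ for each hyperplane's defining linear form; a region is a cell with no zero sign; a hyperplane $H$ of the arrangement is a wall of region $R$ if some cell has the same sign sequence as $R$ except $0$ on $H$. The type $B$ Coxeter arrangement consists of $\{x_i+x_j=0\}$, $\{x_i-x_j=0\}$ ($1\le i<j\le n$) and $\{x_i=0\}$ ($1\le i\le n$).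
   Formalization: The arrangement $\mathcal{D}_n$, the region $D_\pi$, its cells and the type B Coxeter hyperplanes are taken in ℚ^n instead of ℝ^n. -}

module Defs where

open import Data.Nat as ℕ using (ℕ; ∣_-_∣)
open import Data.Fin using (Fin; zero; suc; inject₁; toℕ)
open import Data.Fin.Permutation using (Permutation′; _⟨$⟩ʳ_; _⟨$⟩ˡ_)
open import Data.List using (length; filter; allFin)
open import Data.Rational using (ℚ; 0ℚ; _+_; _-_)
open import Data.Rational.Properties using (_≤?_; <-cmp)
open import Relation.Binary.Definitions using (tri<; tri≈; tri>)
open import Relation.Binary.PropositionalEquality using (_≡_)
open import Data.Product using (Σ; _×_)
open import Relation.Nullary using (¬_)

-- Points of ℚ^n (0-based coordinates x 0 … x (n-1) stand for x_1 … x_n).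
Point : ℕ → Set
Point n = Fin n → ℚ

-- Partial sums: z x k = x_0 + … + x_{k-1} (0-based), i.e. z x 0 = 0 = z_1,
-- z x k = z_{k+1} of the paper.
z : ∀ {n} → Point n → Fin (ℕ.suc n) → ℚ
z x zero                  = 0ℚ
z {ℕ.suc n} x (suc k)     = x zero + z (λ m → x (suc m)) k

-- The linear form of H_{i,j}: x_i + … + x_{j-1} = z_j - z_i.
form : ∀ {n} → Fin (ℕ.suc n) → Fin (ℕ.suc n) → Point n → ℚ
form i j x = z x j - z x i

-- Membership in D_π (0-based: π i + 1 = |{j : z_i ≥ z_j}|, the z's distinct).
inD : ∀ {n} → Permutation′ (ℕ.suc n) → Point n → Set
inD {n} π x =
  ((i j : Fin (ℕ.suc n)) → ¬ (i ≡ j) → ¬ (z x i ≡ z x j)) ×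
  ((i : Fin (ℕ.suc n)) →
     ℕ.suc (toℕ (π ⟨$⟩ʳ i)) ≡ length (filter (λ j → z x j ≤? z x i) (allFin (ℕ.suc n))))

data Sign : Set where
  neg zer pos : Sign

sign : ℚ → Sign
sign q with <-cmp q 0ℚ
... | tri< _ _ _ = neg
... | tri≈ _ _ _ = zer
... | tri> _ _ _ = pos

-- H_{i,j} (i < j) is a wall of D_π: some cell has the sign vector of D_π
-- except 0 on H_{i,j}.
IsWall : ∀ {n} → Permutation′ (ℕ.suc n) → Fin (ℕ.suc n) → Fin (ℕ.suc n) → Set
IsWall {n} π i j =
  Σ (Point n) λ x → inD π x × Σ (Point n) λ y →
    (sign (form i j y) ≡ zer) ×
    ((k l : Fin (ℕ.suc n)) → k Data.Fin.< l → ¬ ((k ≡ i) × (l ≡ j)) →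
       sign (form k l y) ≡ sign (form k l x))

AlmostConsecutive : ∀ {n} → Permutation′ (ℕ.suc n) → Set
AlmostConsecutive {n} π =
  (i : Fin n) → ∣ toℕ (π ⟨$⟩ˡ suc i) - toℕ (π ⟨$⟩ˡ inject₁ i) ∣ ℕ.≤ 2

data BHyp (n : ℕ) : Set where
  plusH  : (a b : Fin n) → a Data.Fin.< b → BHyp n
  minusH : (a b : Fin n) → a Data.Fin.< b → BHyp n
  coordH : (a : Fin n) → BHyp n

onB : ∀ {n} → BHyp n → Point n → Set
onB (plusH a b _)  x = x a + x b ≡ 0ℚ
onB (minusH a b _) x = x a - x b ≡ 0ℚ
onB (coordH a)     x = x a ≡ 0ℚ

module Submission where

-- Let y be a point of the cell that witnesses the wall H_{i,j}: there z_i = z_j, while every other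
-- comparison between the partial sums z_k is the same as on D_π. Hence no z_k lies strictly between
-- z_i and z_j on D_π, i.e. the ranks π(i) and π(j) are consecutive, and almost consecutiveness gives
-- |i − j| ≤ 2. Finally H_{i,i+1} is {x_i = 0} and H_{i,i+2} is {x_i + x_{i+1} = 0}.

open import Defs
open import Data.Nat using (ℕ; suc; _≤_)
open import Data.Fin using (Fin; _<_)
open import Data.Fin.Permutation using (Permutation′)
open import Data.Rational using (0ℚ)
open import Data.Product using (Σ)
open import Function.Bundles using (_⇔_)
open import Relation.Binary.PropositionalEquality using (_≡_)

open import Data.Nat as ℕ using (∣_-_∣)
import Data.Nat.Properties as ℕ
open import Data.Fin as Fin using (zero; suc; inject₁; toℕ; fromℕ<)
import Data.Fin.Properties as Fin
open import Data.Fin.Permutation using (_⟨$⟩ʳ_; _⟨$⟩ˡ_; inverseʳ; inverseˡ)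
open import Data.Rational as ℚ using (ℚ; -_; _+_; _-_)
import Data.Rational.Properties as ℚ
open import Algebra.Properties.Group ℚ.+-0-group using (//-rightDividesˡ; x∙y⁻¹≈ε⇒x≈y)
open import Data.List using (allFin; filter)
open import Data.List.Relation.Binary.Sublist.Propositional using (_⊆_; ⊆-refl)
open import Data.List.Relation.Binary.Sublist.Propositional.Properties
  using (filter⁺; length-mono-≤)
open import Data.Product using (_×_; _,_; proj₁; proj₂; swap)
open import Data.Sum using (inj₁; inj₂)
open import Data.Empty using (⊥-elim)
open import Function.Base using (_∘_; flip)
open import Function.Bundles using (mk⇔)
open import Relation.Binary.Definitions using (tri<; tri≈; tri>)
open import Relation.Binary.PropositionalEquality
  using (refl; sym; trans; cong; subst; subst₂; _≢_; module ≡-Reasoning)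
open import Relation.Nullary using (¬_)

private
  variable
    n : ℕ
    p q p′ q′ : ℚ

p<q⇒0<q-p : p ℚ.< q → 0ℚ ℚ.< q - p
p<q⇒0<q-p {p} {q} p<q = subst (ℚ._< q - p) (ℚ.+-inverseʳ p) (ℚ.+-monoˡ-< (- p) p<q)

q<p⇒q-p<0 : q ℚ.< p → q - p ℚ.< 0ℚ
q<p⇒q-p<0 {q} {p} q<p = subst (q - p ℚ.<_) (ℚ.+-inverseʳ p) (ℚ.+-monoˡ-< (- p) q<p)

0<q-p⇒p<q : 0ℚ ℚ.< q - p → p ℚ.< q
0<q-p⇒p<q {q} {p} lt =
  subst₂ ℚ._<_ (ℚ.+-identityˡ p) (//-rightDividesˡ p q) (ℚ.+-monoˡ-< p lt)

q-p<0⇒q<p : q - p ℚ.< 0ℚ → q ℚ.< p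
q-p<0⇒q<p {q} {p} lt =
  subst₂ ℚ._<_ (//-rightDividesˡ p q) (ℚ.+-identityˡ p) (ℚ.+-monoˡ-< p lt)

sign-pos : 0ℚ ℚ.< q → sign q ≡ pos
sign-pos {q} 0<q with ℚ.<-cmp q 0ℚ
... | tri< q<0 _ _ = ⊥-elim (ℚ.<-asym q<0 0<q)
... | tri≈ _ q≡0 _ = ⊥-elim (ℚ.<-irrefl (sym q≡0) 0<q)
... | tri> _ _ _   = refl

sign-neg : q ℚ.< 0ℚ → sign q ≡ neg
sign-neg {q} q<0 with ℚ.<-cmp q 0ℚ
... | tri< _ _ _   = refl
... | tri≈ _ q≡0 _ = ⊥-elim (ℚ.<-irrefl q≡0 q<0)
... | tri> _ _ 0<q = ⊥-elim (ℚ.<-asym q<0 0<q)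

sign≡pos⇒0< : sign q ≡ pos → 0ℚ ℚ.< q
sign≡pos⇒0< {q} s with ℚ.<-cmp q 0ℚ
sign≡pos⇒0< () | tri< _ _ _
sign≡pos⇒0< () | tri≈ _ _ _
sign≡pos⇒0< _  | tri> _ _ 0<q = 0<q

sign≡neg⇒<0 : sign q ≡ neg → q ℚ.< 0ℚ
sign≡neg⇒<0 {q} s with ℚ.<-cmp q 0ℚ
sign≡neg⇒<0 _  | tri< q<0 _ _ = q<0
sign≡neg⇒<0 () | tri≈ _ _ _
sign≡neg⇒<0 () | tri> _ _ _

sign≡zer⇒≡0 : sign q ≡ zer → q ≡ 0ℚ
sign≡zer⇒≡0 {q} s with ℚ.<-cmp q 0ℚ
sign≡zer⇒≡0 () | tri< _ _ _
sign≡zer⇒≡0 _  | tri≈ _ q≡0 _ = q≡0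
sign≡zer⇒≡0 () | tri> _ _ _

sign-≡⇒<-preserved : sign (q′ - p′) ≡ sign (q - p) →
                     (p ℚ.< q → p′ ℚ.< q′) × (q ℚ.< p → q′ ℚ.< p′)
sign-≡⇒<-preserved s≡ =
  (λ p<q → 0<q-p⇒p<q (sign≡pos⇒0< (trans s≡ (sign-pos (p<q⇒0<q-p p<q))))) ,
  (λ q<p → q-p<0⇒q<p (sign≡neg⇒<0 (trans s≡ (sign-neg (q<p⇒q-p<0 q<p)))))

IsTypeB : Fin (suc n) → Fin (suc n) → Set
IsTypeB {n} i j = Σ (BHyp n) λ h → (x : Point n) → (form i j x ≡ 0ℚ) ⇔ onB h x

[p+q]-[p+r]≡q-r : ∀ p q r → (p + q) - (p + r) ≡ q - r
[p+q]-[p+r]≡q-r p q r = begin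
  (p + q) + - (p + r)    ≡⟨ cong ((p + q) +_) (ℚ.neg-distrib-+ p r) ⟩
  (p + q) + (- p + - r)  ≡⟨ cong (_+ (- p + - r)) (ℚ.+-comm p q) ⟩
  (q + p) + (- p + - r)  ≡⟨ ℚ.+-assoc q p (- p + - r) ⟩
  q + (p + (- p + - r))  ≡⟨ cong (q +_) (ℚ.+-assoc p (- p) (- r)) ⟨
  q + ((p - p) + - r)    ≡⟨ cong (λ t → q + (t + - r)) (ℚ.+-inverseʳ p) ⟩
  q + (0ℚ + - r)         ≡⟨ cong (q +_) (ℚ.+-identityˡ (- r)) ⟩
  q - r                  ∎
  where open ≡-Reasoning

form-suc : ∀ (i j : Fin (suc n)) (x : Point (suc n)) →
           form (suc i) (suc j) x ≡ form i j (λ k → x (suc k))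
form-suc i j x = [p+q]-[p+r]≡q-r (x zero) _ _

shiftB : BHyp n → BHyp (suc n)
shiftB (plusH a b a<b)  = plusH (suc a) (suc b) (ℕ.s≤s a<b)
shiftB (minusH a b a<b) = minusH (suc a) (suc b) (ℕ.s≤s a<b)
shiftB (coordH a)       = coordH (suc a)

onB-shiftB : ∀ (h : BHyp n) x → onB (shiftB h) x ≡ onB h (λ k → x (suc k))
onB-shiftB (plusH _ _ _)  x = refl
onB-shiftB (minusH _ _ _) x = refl
onB-shiftB (coordH _)     x = refl

IsTypeB-suc : {i j : Fin (suc n)} → IsTypeB i j → IsTypeB (suc i) (suc j)
IsTypeB-suc {i = i} {j} (h , form≡0⇔onB) = shiftB h , λ x →
  subst₂ _⇔_ (cong (_≡ 0ℚ) (sym (form-suc i j x))) (sym (onB-shiftB h x))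
         (form≡0⇔onB (λ k → x (suc k)))

≡⇒[≡0⇔≡0] : p ≡ q → (p ≡ 0ℚ) ⇔ (q ≡ 0ℚ)
≡⇒[≡0⇔≡0] p≡q = mk⇔ (trans (sym p≡q)) (trans p≡q)

short⇒IsTypeB : (i j : Fin (suc n)) → i < j → ∣ toℕ j - toℕ i ∣ ≤ 2 → IsTypeB i j
short⇒IsTypeB zero (suc zero) _ _ =
  coordH zero , λ x → ≡⇒[≡0⇔≡0] (trans (ℚ.+-identityʳ (x zero + 0ℚ)) (ℚ.+-identityʳ (x zero)))
short⇒IsTypeB zero (suc (suc zero)) _ _ =
  plusH zero (suc zero) (ℕ.s≤s ℕ.z≤n) , λ x →
    ≡⇒[≡0⇔≡0] (trans (ℚ.+-identityʳ _) (cong (x zero +_) (ℚ.+-identityʳ (x (suc zero)))))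
short⇒IsTypeB zero (suc (suc (suc _))) _ (ℕ.s≤s (ℕ.s≤s ()))
short⇒IsTypeB {suc n} (suc i) (suc j) (ℕ.s≤s i<j) close =
  IsTypeB-suc {i = i} {j} (short⇒IsTypeB i j i<j close)

OrderKeptAt : Point n → Point n → Fin (suc n) → Set
OrderKeptAt x y k = ∀ c → (z x c ℚ.< z x k → z y c ℚ.< z y k) × (z x k ℚ.< z x c → z y k ℚ.< z y c)

SameSignsOff : Fin (suc n) → Fin (suc n) → Point n → Point n → Set
SameSignsOff {n} i j x y = (k l : Fin (suc n)) → k < l → ¬ ((k ≡ i) × (l ≡ j)) →
                           sign (form k l y) ≡ sign (form k l x)

sameSignsOff⇒orderKeptAt : ∀ {i j : Fin (suc n)} {x y} → SameSignsOff i j x y →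
                           ∀ {k} → k ≢ i → k ≢ j → OrderKeptAt x y k
sameSignsOff⇒orderKeptAt same {k} k≢i k≢j c with Fin.<-cmp c k
... | tri< c<k _ _ = sign-≡⇒<-preserved (same c k c<k (k≢j ∘ proj₂))
... | tri≈ _ refl _ = (λ c<c → ⊥-elim (ℚ.<-irrefl refl c<c)) , (λ c<c → ⊥-elim (ℚ.<-irrefl refl c<c))
... | tri> _ _ k<c = swap (sign-≡⇒<-preserved (same k c k<c (k≢i ∘ proj₁)))

module _ (π : Permutation′ (suc n)) where

  rank : Fin (suc n) → ℕ
  rank a = toℕ (π ⟨$⟩ʳ a)

  rank-injective : ∀ {a b} → rank a ≡ rank b → a ≡ b
  rank-injective eq =
    trans (sym (inverseˡ π)) (trans (cong (π ⟨$⟩ˡ_) (Fin.toℕ-injective eq)) (inverseˡ π))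

  unrank : ∀ {m} → m ℕ.< suc n → Fin (suc n)
  unrank m<1+n = π ⟨$⟩ˡ fromℕ< m<1+n

  rank-unrank : ∀ {m} (m<1+n : m ℕ.< suc n) → rank (unrank m<1+n) ≡ m
  rank-unrank m<1+n = trans (cong toℕ (inverseʳ π)) (Fin.toℕ-fromℕ< m<1+n)

  ⟨$⟩ˡ-rank : ∀ {k a} → toℕ k ≡ rank a → π ⟨$⟩ˡ k ≡ a
  ⟨$⟩ˡ-rank eq = trans (cong (π ⟨$⟩ˡ_) (Fin.toℕ-injective eq)) (inverseˡ π)

  consecutive-ranks⇒close : AlmostConsecutive π → ∀ {a b} →
                            rank b ≡ suc (rank a) → ∣ toℕ b - toℕ a ∣ ≤ 2
  consecutive-ranks⇒close almost {a} {b} rb≡1+ra =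
    subst₂ (λ u v → ∣ toℕ u - toℕ v ∣ ≤ 2) (⟨$⟩ˡ-rank rb≡) (⟨$⟩ˡ-rank ra≡)
           (almost m)
    where
    ra<n : rank a ℕ.< n
    ra<n = ℕ.≤-pred (subst (ℕ._< suc n) rb≡1+ra (Fin.toℕ<n (π ⟨$⟩ʳ b)))
    m : Fin n
    m = fromℕ< ra<n
    ra≡ : toℕ (inject₁ m) ≡ rank a
    ra≡ = trans (Fin.toℕ-inject₁ m) (Fin.toℕ-fromℕ< ra<n)
    rb≡ : toℕ (suc m) ≡ rank b
    rb≡ = trans (cong suc (Fin.toℕ-fromℕ< ra<n)) (sym rb≡1+ra)

  module _ {x : Point n} (x∈D : inD π x) where

    rank-mono-≤ : ∀ {a b} → z x a ℚ.≤ z x b → rank a ≤ rank b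
    rank-mono-≤ {a} {b} za≤zb =
      ℕ.≤-pred (subst₂ _≤_ (sym (proj₂ x∈D a)) (sym (proj₂ x∈D b)) (length-mono-≤ below-a⊆below-b))
      where
      below-a⊆below-b : filter (λ c → z x c ℚ.≤? z x a) (allFin (suc n))
                      ⊆ filter (λ c → z x c ℚ.≤? z x b) (allFin (suc n))
      below-a⊆below-b = filter⁺ (λ c → z x c ℚ.≤? z x a) (λ c → z x c ℚ.≤? z x b)
                                (λ { refl zc≤za → ℚ.≤-trans zc≤za za≤zb }) (⊆-refl {x = allFin (suc n)})

    rank-<⇒z-< : ∀ {a b} → rank a ℕ.< rank b → z x a ℚ.< z x b
    rank-<⇒z-< ra<rb = ℚ.≰⇒> (λ zb≤za → ℕ.<⇒≱ ra<rb (rank-mono-≤ zb≤za))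

    module _ {y : Point n} {a b : Fin (suc n)}
             (kept : ∀ {k} → k ≢ a → k ≢ b → OrderKeptAt x y k)
             (ya≡yb : z y a ≡ z y b) where

      merged⇒consecutive-ranks : rank a ℕ.< rank b → rank b ≡ suc (rank a)
      merged⇒consecutive-ranks ra<rb with ℕ.m≤n⇒m<n∨m≡n ra<rb
      ... | inj₂ 1+ra≡rb = sym 1+ra≡rb
      ... | inj₁ 1+ra<rb = ⊥-elim (ℚ.<-irrefl ya≡yb (ℚ.<-trans ya<yk yk<yb))
        where
        1+ra<1+n : suc (rank a) ℕ.< suc n
        1+ra<1+n = ℕ.<-trans 1+ra<rb (Fin.toℕ<n (π ⟨$⟩ʳ b))
        k : Fin (suc n)
        k = unrank 1+ra<1+n
        rk≡1+ra : rank k ≡ suc (rank a)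
        rk≡1+ra = rank-unrank 1+ra<1+n
        ra<rk : rank a ℕ.< rank k
        ra<rk = subst (rank a ℕ.<_) (sym rk≡1+ra) (ℕ.n<1+n (rank a))
        rk<rb : rank k ℕ.< rank b
        rk<rb = subst (ℕ._< rank b) (sym rk≡1+ra) 1+ra<rb
        k-kept : OrderKeptAt x y k
        k-kept = kept (λ k≡a → ℕ.<-irrefl (cong rank (sym k≡a)) ra<rk)
                      (λ k≡b → ℕ.<-irrefl (cong rank k≡b) rk<rb)
        ya<yk : z y a ℚ.< z y k
        ya<yk = proj₁ (k-kept a) (rank-<⇒z-< ra<rk)
        yk<yb : z y k ℚ.< z y b
        yk<yb = proj₂ (k-kept b) (rank-<⇒z-< rk<rb)

sign-form≡zer⇒z≡ : ∀ {i j : Fin (suc n)} {y} → sign (form i j y) ≡ zer → z y i ≡ z y j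
sign-form≡zer⇒z≡ {i = i} {j} {y} s = sym (x∙y⁻¹≈ε⇒x≈y (z y j) (z y i) (sign≡zer⇒≡0 s))

wall⇒close : ∀ (π : Permutation′ (suc n)) → AlmostConsecutive π →
             ∀ {i j x y} → inD π x → SameSignsOff i j x y → sign (form i j y) ≡ zer →
             i < j → ∣ toℕ j - toℕ i ∣ ≤ 2
wall⇒close π almost {i} {j} x∈D same y∈Hij i<j with ℕ.<-cmp (rank π i) (rank π j)
... | tri< ri<rj _ _ =
  consecutive-ranks⇒close π almost
    (merged⇒consecutive-ranks π x∈D (sameSignsOff⇒orderKeptAt same)
                              (sign-form≡zer⇒z≡ {i = i} {j} y∈Hij) ri<rj)
... | tri≈ _ ri≡rj _ = ⊥-elim (Fin.<-irrefl (rank-injective π ri≡rj) i<j)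
... | tri> _ _ rj<ri = subst (_≤ 2) (ℕ.∣-∣-comm (toℕ i) (toℕ j))
  (consecutive-ranks⇒close π almost
    (merged⇒consecutive-ranks π x∈D (flip (sameSignsOff⇒orderKeptAt same))
                              (sym (sign-form≡zer⇒z≡ {i = i} {j} y∈Hij)) rj<ri))

lemma4p8 : (n : ℕ) → 1 ≤ n → (π : Permutation′ (suc n)) → AlmostConsecutive π →
    (i j : Fin (suc n)) → i < j → IsWall π i j →
    Σ (BHyp n) λ h → (x : Point n) → (form i j x ≡ 0ℚ) ⇔ onB h x
lemma4p8 n _ π almost i j i<j (x , x∈D , y , y∈Hij , same) =
  short⇒IsTypeB i j i<j (wall⇒close π almost x∈D same y∈Hij i<j)
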